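{- Let $\mathbf{p}=p_{n-1}\dots p_0$ be an $(m,n)$-parking function and $\Delta$ a bounded, co-bounded $m$-invariant set with $\mathbf{p}\cdot\Delta=\Delta+n$. For $0\le i\le n-1$ put $\Delta^{(i)}=p_{i-1}\cdots p_0\cdot\Delta$ and let $a$ be the $p_i$-th smallest (indexing from $0$) $m$-generator of $\Delta^{(i)}$. Then $a$ is an $n$-generator of the original set $\Delta$.
   Context: $[m]=\{0,\dots,m-1\}$. $\Delta\subset\mathbb{Z}$ is $k$-invariant if $\Delta+k\subset\Delta$; bounded = has a minimum, co-bounded = contains $\mathbb{Z}_{\ge K}$ for some $K$. An element $a\in\Delta$ is a $k$-generator if $a-k\notin\Delta$. For an $m$-invariant $\Delta$ with $m$-generators $a_0<\dots<a_{m-1}$, a letter $j\in[m]$ acts by $j\cdot\Delta=\Delta\setminus\{a_j\}$; words act from right to left (letter $p_0$ first). An $(m,n)$-parking function is $\mathbf{p}=p_{n-1}\dots p_0\in[m]^n$ with $\#\{j:p_j<i\}\ge in/m$ for $1\le i\le m$. -}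

module Defs where

open import Data.Nat as ℕ using (ℕ; zero; suc)
open import Data.Integer as ℤ using (ℤ; +_; _-_; _+_)
open import Data.Fin as Fin using (Fin; toℕ; inject₁; fromℕ)
open import Data.List using (List; length; filter)
open import Data.List using () renaming (map to lmap)
open import Data.Fin using () renaming (_<_ to _<F_)
open import Data.Product using (Σ; ∃; _×_)
open import Relation.Nullary using (¬_)
open import Relation.Binary.PropositionalEquality using (_≡_; _≢_)
open import Data.List using (allFin) public

ZSet : Set₁
ZSet = ℤ → Set

_≐_ : ZSet → ZSet → Set
A ≐ B = ∀ x → (A x → B x) × (B x → A x)

Shift : ZSet → ℕ → ZSet
Shift Δ k x = Δ (x - + k)

Invariant : ℕ → ZSet → Set
Invariant k Δ = ∀ x → Δ x → Δ (x + + k)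

Bounded : ZSet → Set
Bounded Δ = Σ ℤ λ b → Δ b × (∀ x → Δ x → b ℤ.≤ x)

CoBounded : ZSet → Set
CoBounded Δ = Σ ℤ λ K → ∀ x → K ℤ.≤ x → Δ x

Generator : ℕ → ZSet → ℤ → Set
Generator k Δ a = Δ a × ¬ Δ (a - + k)

-- a is the j-th smallest (from 0) m-generator of Δ:
-- the m-generators of Δ are exactly a_0 < … < a_{m-1} and a = a_j
IsGenAt : (m : ℕ) → ZSet → Fin m → ℤ → Set
IsGenAt m Δ j a =
  Σ (Fin m → ℤ) λ g →
    (∀ k l → k <F l → g k ℤ.< g l) ×
    (∀ k → Generator m Δ (g k)) ×
    (∀ x → Generator m Δ x → ∃ λ k → g k ≡ x) ×
    (g j ≡ a)

-- Δ' = j · Δ  (i.e. Δ' = Δ ∖ {a_j})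
Acts : (m : ℕ) → Fin m → ZSet → ZSet → Set
Acts m j Δ Δ' = Σ ℤ λ a → IsGenAt m Δ j a × (Δ' ≐ λ x → Δ x × x ≢ a)

countBelow : {m n : ℕ} → (Fin n → Fin m) → ℕ → ℕ
countBelow {n = n} p i = length (filter (λ j → toℕ (p j) ℕ.<? i) (allFin n))

-- (m,n)-parking function p = p_{n-1} … p_0, given as j ↦ p_j
-- condition #{j : p_j < i} ≥ i n / m, i.e. i * n ≤ m * #{…}, for 1 ≤ i ≤ m
IsParking : (m n : ℕ) → (Fin n → Fin m) → Set
IsParking m n p = ∀ i → 1 ℕ.≤ i → i ℕ.≤ m → i ℕ.* n ℕ.≤ m ℕ.* countBelow p i

{-# OPTIONS --safe #-}
-- Each letter only deletes an element, so Δ = Δ⁽⁰⁾ ⊇ Δ⁽¹⁾ ⊇ ⋯ ⊇ Δ⁽ⁿ⁾ = Δ + n.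
-- The generator a lies in Δ⁽ⁱ⁾ ⊆ Δ and is the element deleted by pᵢ, so
-- a ∉ Δ⁽ⁱ⁺¹⁾ ⊇ Δ + n, that is a − n ∉ Δ.
module Submission where

open import Defs
open import Data.Empty using (⊥-elim)
open import Data.Fin using (Fin; zero; suc; inject₁; fromℕ)
open import Data.Fin as Fin using ()
open import Data.Integer using (ℤ; _-_; +_)
import Data.Integer.Properties as ℤ
open import Data.Nat using (ℕ; z<s; s<s)
open import Data.Product using (∃; _,_; proj₁; proj₂)
open import Data.Vec.Functional using (tail)
open import Level using (Level)
open import Relation.Binary.Core using (Rel)
open import Relation.Binary.PropositionalEquality using (_≡_; refl; sym; trans)
open import Relation.Binary.Structures using (IsStrictPartialOrder)
open import Relation.Nullary using (¬_)
open import Relation.Unary using (Pred; _⊆_; _∉_)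

private
  variable
    a ℓ : Level
    A : Set a

Descending : {n : ℕ} → (Fin (ℕ.suc n) → Pred A ℓ) → Set _
Descending D = ∀ i → D (suc i) ⊆ D (inject₁ i)

descending-⊆-head : {n : ℕ} (D : Fin (ℕ.suc n) → Pred A ℓ) →
                    Descending D → ∀ k → D k ⊆ D zero
descending-⊆-head D desc zero x∈ = x∈
descending-⊆-head {n = ℕ.suc n} D desc (suc k) x∈ =
  desc zero (descending-⊆-head (tail D) (λ i → desc (suc i)) k x∈)

descending-last-⊆ : {n : ℕ} (D : Fin (ℕ.suc n) → Pred A ℓ) →
                    Descending D → ∀ k → D (fromℕ n) ⊆ D k
descending-last-⊆ D desc zero = descending-⊆-head D desc (fromℕ _)
descending-last-⊆ {n = ℕ.suc n} D desc (suc k) =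
  descending-last-⊆ (tail D) (λ i → desc (suc i)) k

range : {m : ℕ} → (Fin m → A) → Pred A _
range g x = ∃ λ k → g k ≡ x

module _ {_<_ : Rel A ℓ} (<-spo : IsStrictPartialOrder _≡_ _<_) where
  open IsStrictPartialOrder <-spo using (irrefl; asym; <-respʳ-≈)

  StrictlyIncreasing : {m : ℕ} → (Fin m → A) → Set _
  StrictlyIncreasing g = ∀ k l → k Fin.< l → g k < g l

  strictlyIncreasing-tail : {m : ℕ} {g : Fin (ℕ.suc m) → A} →
                            StrictlyIncreasing g → StrictlyIncreasing (tail g)
  strictlyIncreasing-tail g↑ k l k<l = g↑ (suc k) (suc l) (s<s k<l)

  strictlyIncreasing-head-unique :
    {m : ℕ} {g h : Fin (ℕ.suc m) → A} → StrictlyIncreasing g → StrictlyIncreasing h →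
    range g ⊆ range h → range h ⊆ range g → g zero ≡ h zero
  strictlyIncreasing-head-unique g↑ h↑ g⊆h h⊆g
    with g⊆h (zero , refl) | h⊆g (zero , refl)
  ... | zero , h0≡g0 | _ = sym h0≡g0
  ... | _ | zero , g0≡h0 = g0≡h0
  ... | suc l , hl≡g0 | suc l′ , gl′≡h0 =
    ⊥-elim (asym (<-respʳ-≈ hl≡g0 (h↑ zero (suc l) z<s))
                 (<-respʳ-≈ gl′≡h0 (g↑ zero (suc l′) z<s)))

  range-tail-⊆ : {m : ℕ} {g h : Fin (ℕ.suc m) → A} → StrictlyIncreasing g →
                 h zero ≡ g zero → range g ⊆ range h → range (tail g) ⊆ range (tail h)
  range-tail-⊆ g↑ h0≡g0 g⊆h (k , refl) with g⊆h (suc k , refl)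
  ... | zero , h0≡gk = ⊥-elim (irrefl (trans (sym h0≡g0) h0≡gk) (g↑ zero (suc k) z<s))
  ... | suc l , hl≡gk = l , hl≡gk

  strictlyIncreasing-range-unique :
    {m : ℕ} {g h : Fin m → A} → StrictlyIncreasing g → StrictlyIncreasing h →
    range g ⊆ range h → range h ⊆ range g → ∀ k → g k ≡ h k
  strictlyIncreasing-range-unique g↑ h↑ g⊆h h⊆g zero =
    strictlyIncreasing-head-unique g↑ h↑ g⊆h h⊆g
  strictlyIncreasing-range-unique {g = g} {h} g↑ h↑ g⊆h h⊆g (suc k) =
    strictlyIncreasing-range-unique
      (strictlyIncreasing-tail g↑) (strictlyIncreasing-tail h↑)
      (range-tail-⊆ g↑ (sym g0≡h0) g⊆h) (range-tail-⊆ h↑ g0≡h0 h⊆g) k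
    where
    g0≡h0 : g zero ≡ h zero
    g0≡h0 = strictlyIncreasing-head-unique g↑ h↑ g⊆h h⊆g

isGenAt-unique : {m : ℕ} {Δ : ZSet} {j : Fin m} {a b : ℤ} →
                 IsGenAt m Δ j a → IsGenAt m Δ j b → a ≡ b
isGenAt-unique {j = j} (g , g↑ , g-gen , g-onto , refl) (h , h↑ , h-gen , h-onto , refl) =
  strictlyIncreasing-range-unique ℤ.<-isStrictPartialOrder g↑ h↑
    (λ { (k , refl) → h-onto (g k) (g-gen k) })
    (λ { (k , refl) → g-onto (h k) (h-gen k) })
    j

isGenAt-∈ : {m : ℕ} {Δ : ZSet} {j : Fin m} {a : ℤ} → IsGenAt m Δ j a → Δ a
isGenAt-∈ {j = j} (g , _ , g-gen , _ , refl) = proj₁ (g-gen j)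

acts-⊆ : {m : ℕ} {j : Fin m} {Δ Δ′ : ZSet} → Acts m j Δ Δ′ → Δ′ ⊆ Δ
acts-⊆ (_ , _ , Δ′≐) {x} x∈Δ′ = proj₁ (proj₁ (Δ′≐ x) x∈Δ′)

acts-removes : {m : ℕ} {j : Fin m} {Δ Δ′ : ZSet} {a : ℤ} →
               Acts m j Δ Δ′ → IsGenAt m Δ j a → a ∉ Δ′
acts-removes (b , b-gen , Δ′≐) a-gen a∈Δ′ =
  proj₂ (proj₁ (Δ′≐ _) a∈Δ′) (isGenAt-unique a-gen b-gen)

mainTheorem7 : (m n : ℕ) (p : Fin n → Fin m) (Δ : ZSet) →
    IsParking m n p →
    Bounded Δ → CoBounded Δ → Invariant m Δ →
    -- D i = Δ^{(i)} = p_{i-1} ⋯ p_0 · Δ, for 0 ≤ i ≤ n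
    (D : Fin (ℕ.suc n) → ZSet) →
    D zero ≐ Δ →
    (∀ (i : Fin n) → Acts m (p i) (D (inject₁ i)) (D (suc i))) →
    -- p · Δ = Δ + n
    D (fromℕ n) ≐ Shift Δ n →
    ∀ (i : Fin n) (a : ℤ) → IsGenAt m (D (inject₁ i)) (p i) a →
    Generator n Δ a
mainTheorem7 m n p Δ _ _ _ _ D D₀≐Δ acts Dₙ≐Δ+n i a a-gen = a∈Δ , a-n∉Δ
  where
  desc : Descending D
  desc i = acts-⊆ (acts i)

  a∈Δ : Δ a
  a∈Δ = proj₁ (D₀≐Δ a) (descending-⊆-head D desc (inject₁ i) (isGenAt-∈ a-gen))

  a-n∉Δ : ¬ Δ (a - + n)
  a-n∉Δ a-n∈Δ = acts-removes (acts i) a-gen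
    (descending-last-⊆ D desc (suc i) (proj₂ (Dₙ≐Δ+n a) a-n∈Δ))
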